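{- Let $G=(V^+,V^-;E)$ be a bipartite graph with $|V^+|<|V^-|$. Construct the balanced bipartite graph $G'=(V^+\cup Z^+,V^-;E')$ as follows: - $Z^+$ is a set of new vertices, disjoint from $V^+\cup V^-$, with $|Z^+|=|V^-|-|V^+|$; - $E'=E\cup(Z^+\times V^-)$. Then $G$ is DM-irreducible if and only if $G'$ is DM-irreducible.
   Context: A bipartite graph $G=(V^+,V^-;E)$ has finite disjoint vertex sides $V^+,V^-$, and its edge set satisfies $E\subseteq V^+\times V^-$. For $X\subseteq V^+$, $\Gamma_G(X)$ is the set of vertices of $V^-$ adjacent to some vertex of $X$. DM-decomposition. Define $f_G(X)=|\Gamma_G(X)|-|X|$ for $X\subseteq V^+$. Its minimizers form a lattice under union and intersection. Take a maximal chain $X_0\subsetneq\cdots\subsetneq X_k$ of minimizers and set: - $V_0=X_0\cup\Gamma_G(X_0)$; - $V_i=(X_i\setminus X_{i-1})\cup(\Gamma_G(X_i)\setminus\Gamma_G(X_{i-1}))$ for $i=1,\dots,k$; - $V_\infty=(V^+\setminus X_k)\cup(V^-\setminus\Gamma_G(X_k))$. This partition of $V=V^+\cup V^-$ is independent of the chain. $G$ is DM-irreducible if exactly one part is nonempty, i.e. $V_0=V$, or $V_1=V$, or $V_\infty=V$. -}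

module Defs where

open import Data.Bool using (Bool; true; false; _∧_; _∨_)
open import Data.Nat using (ℕ; zero; suc; _∸_; _+_)
open import Data.Fin using (Fin; zero; suc; inject₁; splitAt; toℕ; fromℕ)
open import Data.Fin.Subset using (Subset; _⊆_; _⊂_; ⊤; _─_; ∁; ∣_∣)
open import Data.Vec using (tabulate; lookup)
open import Data.Integer using (ℤ; +_; _-_; _≤_)
open import Data.Product using (Σ; _×_; ∃)
open import Data.Sum using (_⊎_; inj₁; inj₂)
open import Relation.Binary.PropositionalEquality using (_≡_)

-- A bipartite graph G = (V⁺, V⁻; E) with V⁺ = Fin m, V⁻ = Fin n,
-- and E ⊆ V⁺ × V⁻ given by its (Boolean) indicator function.
Graph : ℕ → ℕ → Set
Graph m n = Fin m → Fin n → Bool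

anyFin : ∀ {m} → (Fin m → Bool) → Bool
anyFin {zero}  p = false
anyFin {suc m} p = p zero ∨ anyFin (λ i → p (suc i))

Γ : ∀ {m n} → Graph m n → Subset m → Subset n
Γ E X = tabulate (λ y → anyFin (λ x → lookup X x ∧ E x y))

f : ∀ {m n} → Graph m n → Subset m → ℤ
f E X = + ∣ Γ E X ∣ - + ∣ X ∣

IsMinimizer : ∀ {m n} → Graph m n → Subset m → Set
IsMinimizer E X = ∀ Y → f E X ≤ f E Y

record Chain {m n} (E : Graph m n) : Set where
  field
    k      : ℕ
    X      : Fin (suc k) → Subset m
    isMin  : ∀ i → IsMinimizer E (X i)
    strict : ∀ (i : Fin k) → X (inject₁ i) ⊂ X (suc i)

open Chain public

Comparable : ∀ {m} → Subset m → Subset m → Set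
Comparable A B = A ⊆ B ⊎ B ⊆ A

IsMaximal : ∀ {m n} {E : Graph m n} → Chain E → Set
IsMaximal {E = E} C =
  ∀ Y → IsMinimizer E Y → (∀ i → Comparable Y (X C i)) → ∃ λ i → X C i ≡ Y

-- The parts V_0, V_1 (when k ≥ 1), V_∞, each given as (plus part, minus part).
-- "Part = V" means both its V⁺-part and V⁻-part are full.
V₀IsAll : ∀ {m n} (E : Graph m n) → Chain E → Set
V₀IsAll E C = (X C zero ≡ ⊤) × (Γ E (X C zero) ≡ ⊤)

V₁IsAll : ∀ {m n} (E : Graph m n) → Chain E → Set
V₁IsAll E C = (k C ≡ 1) × Σ (Fin (suc (k C))) λ one → (toℕ one ≡ 1) ×
  ((X C one ─ X C zero) ≡ ⊤) × ((Γ E (X C one) ─ Γ E (X C zero)) ≡ ⊤)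

V∞IsAll : ∀ {m n} (E : Graph m n) → Chain E → Set
V∞IsAll E C = (∁ (X C (fromℕ (k C))) ≡ ⊤) × (∁ (Γ E (X C (fromℕ (k C)))) ≡ ⊤)

-- DM-irreducible: for a (every) maximal chain of minimizers, exactly one
-- part of the resulting partition is nonempty, i.e. V₀ = V, V₁ = V or V_∞ = V.
DMIrreducible : ∀ {m n} → Graph m n → Set
DMIrreducible E = ∀ (C : Chain E) → IsMaximal C →
  V₀IsAll E C ⊎ V₁IsAll E C ⊎ V∞IsAll E C

-- G' = (V⁺ ∪ Z⁺, V⁻; E ∪ (Z⁺ × V⁻)) with |Z⁺| = n ∸ m;
-- V⁺ ∪ Z⁺ is represented by Fin (m + (n ∸ m)), Z⁺ being the last n ∸ m indices.
extend : ∀ {m n} → Graph m n → Graph (m + (n ∸ m)) n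
extend {m} E x y with splitAt m x
... | inj₁ v = E v y
... | inj₂ _ = true

-- The proof runs through one intermediate property: "∅ is the only minimizer
-- of f_G(X) = |Γ(X)| - |X|".
--  * For every graph this property implies DM-irreducibility (V_∞ = V); when
--    |V⁺| < |V⁻| the converse holds too, because a maximal chain of
--    minimizers exists and V₀ = V or V₁ = V would need a full minimizer
--    with f = |V⁻| - |V⁺| > 0 = f(∅).
--  * In the padded graph G' a set meeting Z⁺ has f = |V⁻| - |Y| ≥ 0, with
--    equality only for Y = V⁺ ∪ Z⁺, while a set Y = A ∪ ∅ keeps f_G(A).
--    Hence ∅ is the unique minimizer of G exactly when the minimizers of G'
--    are exactly ∅ and V⁺ ∪ Z⁺, which is exactly when G' is DM-irreducible
--    with V₁ = V.
module Submission where

open import Defs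
open import Data.Nat using (ℕ; _<_)
open import Function.Bundles using (_⇔_; mk⇔)

open import Data.Nat using (zero; suc; _+_; _∸_; _≤_; z≤n; s≤s)

open import Data.Bool using (Bool; true; false; _∧_; _∨_)
open import Data.Bool.Properties using (∨-identityʳ; ∨-zeroʳ; ∨-assoc)
open import Data.Empty using (⊥-elim)
open import Data.Fin as Fin using (Fin; zero; suc; inject₁; fromℕ; _↑ˡ_; _↑ʳ_)
open import Data.Fin.Properties as FinP using (toℕ-fromℕ; toℕ-injective; splitAt-↑ˡ; splitAt-↑ʳ)
open import Data.Fin.Subset using (Subset; _⊆_; _⊂_; ⊤; ⊥; _─_; ∁; ∣_∣; _∈_)
open import Data.Fin.Subset.Properties
  using ( _⊆?_; _∈?_; anySubset?; ⊆-refl; ⊆-trans; ⊆-antisym; ⊂-trans; ⊥⊆; ⊆⊤; ∈⊤; ∉⊥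
        ; ∣p∣≤n; ∣p∣≡n⇒p≡⊤; p⊂q⇒∣p∣<∣q∣; nonempty?; Empty-unique; ∣⊥∣≡0; ∣⊤∣≡n
        ; p─⊥≡p; p─q⊆p; x∈p⇒x∉∁p; x∉p⇒x∈∁p)
open import Data.Integer as ℤ using (+_; 0ℤ; +≤+)
open import Data.Integer.Properties as ℤP
  using (drop‿+≤+; i-j≤0⇒i≤j; i≤j⇒0≤j-i; +-inverseʳ)
open import Data.List as List using (List; []; _∷_; length)
open import Data.List.Properties using (tabulate-lookup)
open import Data.List.Relation.Unary.All as All using (All; []; _∷_)
open import Data.List.Relation.Unary.All.Properties using (tabulate⁺)
open import Data.List.Relation.Unary.Any using (here; there; index)
open import Data.List.Relation.Unary.Any.Properties using (lookup-index)
open import Data.List.Relation.Unary.AllPairs using (AllPairs; []; _∷_)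
open import Data.List.Membership.Propositional using () renaming (_∈_ to _∈ˡ_; _∉_ to _∉ˡ_)
open import Data.List.Membership.Propositional.Properties using (∈-++⁺ˡ; ∈-++⁺ʳ; ∈-map⁺; ∈-lookup)
import Data.List.Membership.DecPropositional as DecMembership
open import Data.List.Extrema ℤP.≤-totalOrder using (argmin; f[argmin]≤f[xs])
import Data.Nat.Properties as ℕP
open import Data.Product using (Σ; _×_; ∃; _,_; proj₁; proj₂)
open import Data.Sum using (_⊎_; inj₁; inj₂)
open import Data.Vec as Vec using ([]; _∷_; _++_; tabulate; lookup; replicate)
open import Data.Vec.Properties
  using (≡-dec; tabulate-cong; lookup-replicate; lookup-++ˡ; lookup-++ʳ; ++-injectiveˡ; []=⇒lookup)
open import Function using (_∘_)
open import Relation.Nullary using (¬_; Dec; yes; no; contradiction)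
open import Relation.Nullary.Decidable using (decidable-stable; ¬?; _×-dec_; _⊎-dec_)
open import Relation.Binary.PropositionalEquality
  using (_≡_; _≢_; refl; sym; trans; cong; cong₂; subst; subst₂; module ≡-Reasoning)

⊤≢⊥ : ∀ {a} → Fin a → ⊤ {a} ≢ ⊥
⊤≢⊥ x ⊤≡⊥ = ∉⊥ (subst (x ∈_) ⊤≡⊥ ∈⊤)

⊄⊥ : ∀ {a} {p : Subset a} → ¬ (p ⊂ ⊥)
⊄⊥ (_ , x , x∈⊥ , _) = ∉⊥ x∈⊥

⊤⊄ : ∀ {a} {p : Subset a} → ¬ (⊤ ⊂ p)
⊤⊄ (_ , x , _ , x∉⊤) = x∉⊤ ∈⊤

≡⊥⇒⊆ : ∀ {a} {p q : Subset a} → p ≡ ⊥ → p ⊆ q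
≡⊥⇒⊆ refl = ⊥⊆

≡⊤⇒⊇ : ∀ {a} {p q : Subset a} → p ≡ ⊤ → q ⊆ p
≡⊤⇒⊇ refl = ⊆⊤

─≡⊤⇒≡⊤ : ∀ {a} {p q : Subset a} → p ─ q ≡ ⊤ → p ≡ ⊤
─≡⊤⇒≡⊤ {p = p} {q} eq = ⊆-antisym ⊆⊤ (subst (_⊆ p) eq (p─q⊆p p q))

∁≡⊤⇒≡⊥ : ∀ {a} {p : Subset a} → ∁ p ≡ ⊤ → p ≡ ⊥
∁≡⊤⇒≡⊥ eq = ⊆-antisym (λ x∈p → contradiction (subst (_ ∈_) (sym eq) ∈⊤) (x∈p⇒x∉∁p x∈p)) ⊥⊆

≡⊥⇒∁≡⊤ : ∀ {a} {p : Subset a} → p ≡ ⊥ → ∁ p ≡ ⊤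
≡⊥⇒∁≡⊤ refl = ⊆-antisym ⊆⊤ (λ _ → x∉p⇒x∈∁p ∉⊥)

⊆∧≢⇒⊂ : ∀ {a} {p q : Subset a} → p ⊆ q → p ≢ q → p ⊂ q
⊆∧≢⇒⊂ {p = p} {q} p⊆q p≢q with FinP.any? (λ x → (x ∈? q) ×-dec ¬? (x ∈? p))
... | yes witness = p⊆q , witness
... | no none = contradiction (⊆-antisym p⊆q q⊆p) p≢q
  where
  q⊆p : q ⊆ p
  q⊆p {x} x∈q = decidable-stable (x ∈? p) (λ x∉p → none (x , x∈q , x∉p))

⊥++⊥ : ∀ a {b} → ⊥ {a} ++ ⊥ {b} ≡ ⊥
⊥++⊥ zero    = refl
⊥++⊥ (suc a) = cong (false ∷_) (⊥++⊥ a)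

∣p++⊥∣≡∣p∣ : ∀ {a b} (p : Subset a) → ∣ p ++ ⊥ {b} ∣ ≡ ∣ p ∣
∣p++⊥∣≡∣p∣ {b = b} []          = ∣⊥∣≡0 b
∣p++⊥∣≡∣p∣         (true  ∷ p) = cong suc (∣p++⊥∣≡∣p∣ p)
∣p++⊥∣≡∣p∣         (false ∷ p) = ∣p++⊥∣≡∣p∣ p

anyFin-true : ∀ {k} {p : Fin k → Bool} i → p i ≡ true → anyFin p ≡ true
anyFin-true {p = p} zero    pi≡true = cong (_∨ anyFin (p ∘ suc)) pi≡true
anyFin-true {p = p} (suc i) pi≡true =
  trans (cong (p zero ∨_) (anyFin-true {p = p ∘ suc} i pi≡true)) (∨-zeroʳ (p zero))

anyFin-false : ∀ {k} {p : Fin k → Bool} → (∀ i → p i ≡ false) → anyFin p ≡ false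
anyFin-false {zero}  _      = refl
anyFin-false {suc k} p≡false = cong₂ _∨_ (p≡false zero) (anyFin-false (p≡false ∘ suc))

anyFin-cong : ∀ {k} {p q : Fin k → Bool} → (∀ i → p i ≡ q i) → anyFin p ≡ anyFin q
anyFin-cong {zero}  _   = refl
anyFin-cong {suc k} p≗q = cong₂ _∨_ (p≗q zero) (anyFin-cong (p≗q ∘ suc))

anyFin-++ : ∀ a {b} (p : Fin (a + b) → Bool) →
  anyFin p ≡ anyFin (λ i → p (i ↑ˡ b)) ∨ anyFin (λ j → p (a ↑ʳ j))
anyFin-++ zero    p = refl
anyFin-++ (suc a) p = trans (cong (p zero ∨_) (anyFin-++ a (p ∘ suc))) (sym (∨-assoc (p zero) _ _))

tabulate-const : ∀ {k} {g : Fin k → Bool} {c : Bool} → (∀ i → g i ≡ c) → tabulate g ≡ replicate k c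
tabulate-const {zero}  _     = refl
tabulate-const {suc k} g≡c = cong₂ _∷_ (g≡c zero) (tabulate-const (g≡c ∘ suc))

Γ-⊥ : ∀ {a b} (G : Graph a b) → Γ G ⊥ ≡ ⊥
Γ-⊥ G = tabulate-const λ y → anyFin-false λ x → cong (_∧ G x y) (lookup-replicate x false)

-- The deficiency function f and its minimizers

f-⊥ : ∀ {a b} (G : Graph a b) → f G ⊥ ≡ 0ℤ
f-⊥ {a} {b} G = cong₂ (λ c d → + c ℤ.- + d) (trans (cong ∣_∣ (Γ-⊥ G)) (∣⊥∣≡0 b)) (∣⊥∣≡0 a)

minimizer-≡f : ∀ {a b} {G : Graph a b} {X Y} → f G X ≡ f G Y → IsMinimizer G X → IsMinimizer G Y
minimizer-≡f {G = G} X≡Y minX W = subst (ℤ._≤ f G W) X≡Y (minX W)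

-- If |V⁺| < |V⁻|, no minimizer is full with full neighbourhood, since such
-- a set has f = |V⁻| - |V⁺| > 0 = f(∅).
no-full-minimizer : ∀ {a b} {G : Graph a b} {X} → a < b →
  X ≡ ⊤ → Γ G X ≡ ⊤ → ¬ IsMinimizer G X
no-full-minimizer {a} {b} {G} a<b refl Γ⊤≡⊤ minX = ℕP.<⇒≱ a<b (drop‿+≤+ (i-j≤0⇒i≤j f⊤≤0))
  where
  f⊤≤0 : + b ℤ.- + a ℤ.≤ 0ℤ
  f⊤≤0 = subst₂ ℤ._≤_
    (cong₂ (λ c d → + c ℤ.- + d) (trans (cong ∣_∣ Γ⊤≡⊤) (∣⊤∣≡n b)) (∣⊤∣≡n a))
    (f-⊥ G) (minX ⊥)

OnlyEmptyMinimizer : ∀ {a b} → Graph a b → Set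
OnlyEmptyMinimizer G = ∀ Y → IsMinimizer G Y → Y ≡ ⊥

module Minimizers {a b : ℕ} (G : Graph a b) where

  minimizer? : (X : Subset a) → Dec (IsMinimizer G X)
  minimizer? X with anySubset? (λ Y → ¬? (f G X ℤ.≤? f G Y))
  ... | yes (Y , fX≰fY) = no λ minX → fX≰fY (minX Y)
  ... | no none         = yes λ Y → decidable-stable (f G X ℤ.≤? f G Y) (λ fX≰fY → none (Y , fX≰fY))

  subsets : ∀ k → List (Subset k)
  subsets zero    = [] ∷ []
  subsets (suc k) = List.map (true ∷_) (subsets k) List.++ List.map (false ∷_) (subsets k)

  ∈-subsets : ∀ {k} (X : Subset k) → X ∈ˡ subsets k
  ∈-subsets []                  = here refl
  ∈-subsets {suc k} (true  ∷ X) = ∈-++⁺ˡ (∈-map⁺ (true ∷_) (∈-subsets X))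
  ∈-subsets {suc k} (false ∷ X) = ∈-++⁺ʳ (List.map (true ∷_) (subsets k)) (∈-map⁺ (false ∷_) (∈-subsets X))

  minimizer-exists : Σ (Subset a) (IsMinimizer G)
  minimizer-exists = argmin (f G) ⊥ (subsets a)
                   , λ Y → All.lookup (f[argmin]≤f[xs] {f = f G} ⊥ (subsets a)) (∈-subsets Y)

  only-empty⇒⊥-minimizer : OnlyEmptyMinimizer G → IsMinimizer G ⊥
  only-empty⇒⊥-minimizer only-∅ =
    subst (IsMinimizer G) (only-∅ (proj₁ minimizer-exists) (proj₂ minimizer-exists)) (proj₂ minimizer-exists)

open Minimizers using (minimizer-exists; only-empty⇒⊥-minimizer)

-- Chains of minimizers

Top : ∀ {a b} {G : Graph a b} → Chain G → Subset a
Top C = X C (fromℕ (k C))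

increasing-⊆-last : ∀ {a} k (S : Fin (suc k) → Subset a) → (∀ j → S (inject₁ j) ⊂ S (suc j)) →
  ∀ i → S i ⊆ S (fromℕ k)
increasing-⊆-last zero    S _   zero    = ⊆-refl
increasing-⊆-last (suc k) S inc zero    = ⊆-trans (proj₁ (inc zero)) (increasing-⊆-last k (S ∘ suc) (inc ∘ suc) zero)
increasing-⊆-last (suc k) S inc (suc i) = increasing-⊆-last k (S ∘ suc) (inc ∘ suc) i

increasing-first-⊆ : ∀ {a} k (S : Fin (suc k) → Subset a) → (∀ j → S (inject₁ j) ⊂ S (suc j)) →
  ∀ i → S zero ⊆ S i
increasing-first-⊆ k       S _   zero    = ⊆-refl
increasing-first-⊆ (suc k) S inc (suc i) = ⊆-trans (proj₁ (inc zero)) (increasing-first-⊆ k (S ∘ suc) (inc ∘ suc) i)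

two-valued-length : ∀ {a} k (S : Fin (suc k) → Subset a) → (∀ j → S (inject₁ j) ⊂ S (suc j)) →
  (∀ i → S i ≡ ⊥ ⊎ S i ≡ ⊤) → S zero ≡ ⊥ → S (fromℕ k) ≡ ⊤ → ⊤ {a} ≢ ⊥ → k ≡ 1
two-valued-length zero          S _   _      S₀≡⊥ S₀≡⊤ ⊤≢⊥ = ⊥-elim (⊤≢⊥ (trans (sym S₀≡⊤) S₀≡⊥))
two-valued-length (suc zero)    S _   _      _    _    _   = refl
two-valued-length (suc (suc k)) S inc values _    _    _   with values (suc zero)
... | inj₁ S₁≡⊥ = ⊥-elim (⊄⊥ (subst (S zero ⊂_) S₁≡⊥ (inc zero)))
... | inj₂ S₁≡⊤ = ⊥-elim (⊤⊄ (subst (_⊂ S (suc (suc zero))) S₁≡⊤ (inc (suc zero))))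

module _ {a b : ℕ} {G : Graph a b} (C : Chain G) (maxC : IsMaximal C) where

  below-top : ∀ i → X C i ⊆ Top C
  below-top = increasing-⊆-last (k C) (X C) (strict C)

  above-bottom : ∀ i → X C zero ⊆ X C i
  above-bottom = increasing-first-⊆ (k C) (X C) (strict C)

  maximal-above-top : ∀ {Y} → IsMinimizer G Y → Top C ⊆ Y → Y ≡ Top C
  maximal-above-top {Y} minY top⊆Y with maxC Y minY (λ i → inj₂ (⊆-trans (below-top i) top⊆Y))
  ... | i , Xi≡Y = ⊆-antisym (subst (_⊆ Top C) Xi≡Y (below-top i)) top⊆Y

  maximal-below-bottom : ∀ {Y} → IsMinimizer G Y → Y ⊆ X C zero → Y ≡ X C zero
  maximal-below-bottom {Y} minY Y⊆bottom with maxC Y minY (λ i → inj₁ (⊆-trans Y⊆bottom (above-bottom i)))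
  ... | i , Xi≡Y = ⊆-antisym Y⊆bottom (subst (X C zero ⊆_) Xi≡Y (above-bottom i))

  maximal-two-members : k C ≡ 1 → X C zero ≡ ⊥ → Top C ≡ ⊤ →
    ∀ {Y} → IsMinimizer G Y → Y ≡ ⊥ ⊎ Y ≡ ⊤
  maximal-two-members k≡1 bottom≡⊥ top≡⊤ {Y} minY =
    subst (λ S → S ≡ ⊥ ⊎ S ≡ ⊤) (proj₂ found) (member (proj₁ found))
    where
    ends : ∀ {k} → k ≡ 1 → (i : Fin (suc k)) → i ≡ zero ⊎ i ≡ fromℕ k
    ends refl zero       = inj₁ refl
    ends refl (suc zero) = inj₂ refl

    member : ∀ i → X C i ≡ ⊥ ⊎ X C i ≡ ⊤
    member i with ends k≡1 i
    ... | inj₁ refl = inj₁ bottom≡⊥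
    ... | inj₂ refl = inj₂ top≡⊤

    comparable : ∀ i → Comparable Y (X C i)
    comparable i with member i
    ... | inj₁ Xi≡⊥ = inj₂ (≡⊥⇒⊆ Xi≡⊥)
    ... | inj₂ Xi≡⊤ = inj₁ (≡⊤⇒⊇ Xi≡⊤)

    found : ∃ λ i → X C i ≡ Y
    found = maxC Y minY comparable

V₁-full : ∀ {a b} {G : Graph a b} (C : Chain G) → V₁IsAll G C →
  k C ≡ 1 × Top C ≡ ⊤ × Γ G (Top C) ≡ ⊤
V₁-full {G = G} C (k≡1 , one , one≡1 , X-diff , Γ-diff) =
  k≡1 , subst (λ i → X C i ≡ ⊤) one≡top (─≡⊤⇒≡⊤ X-diff)
      , subst (λ i → Γ G (X C i) ≡ ⊤) one≡top (─≡⊤⇒≡⊤ Γ-diff)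
  where
  one≡top : one ≡ fromℕ (k C)
  one≡top = toℕ-injective (trans one≡1 (sym (trans (toℕ-fromℕ (k C)) k≡1)))

V₁-intro : ∀ {a b} {G : Graph a b} (C : Chain G) →
  k C ≡ 1 → X C zero ≡ ⊥ → Top C ≡ ⊤ → Γ G ⊤ ≡ ⊤ → V₁IsAll G C
V₁-intro {G = G} C k≡1 bottom≡⊥ top≡⊤ Γ⊤≡⊤ =
  k≡1 , fromℕ (k C) , trans (toℕ-fromℕ (k C)) k≡1 , X-diff , Γ-diff
  where
  X-diff : Top C ─ X C zero ≡ ⊤
  X-diff = subst₂ (λ p q → p ─ q ≡ ⊤) (sym top≡⊤) (sym bottom≡⊥) (p─⊥≡p ⊤)
  Γ-diff : Γ G (Top C) ─ Γ G (X C zero) ≡ ⊤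
  Γ-diff = subst₂ (λ p q → Γ G p ─ Γ G q ≡ ⊤) (sym top≡⊤) (sym bottom≡⊥)
             (trans (cong₂ _─_ Γ⊤≡⊤ (Γ-⊥ G)) (p─⊥≡p ⊤))

V∞-empty : ∀ {a b} {G : Graph a b} (C : Chain G) → V∞IsAll G C → Top C ≡ ⊥
V∞-empty C (∁top≡⊤ , _) = ∁≡⊤⇒≡⊥ ∁top≡⊤

only-empty⇒irreducible : ∀ {a b} {G : Graph a b} → OnlyEmptyMinimizer G → DMIrreducible G
only-empty⇒irreducible {G = G} only-∅ C _ =
  inj₂ (inj₂ (≡⊥⇒∁≡⊤ top≡⊥ , ≡⊥⇒∁≡⊤ (trans (cong (Γ G) top≡⊥) (Γ-⊥ G))))
  where
  top≡⊥ : Top C ≡ ⊥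
  top≡⊥ = only-∅ (Top C) (isMin C (fromℕ (k C)))

-- Existence of a maximal chain: starting from the empty list, insert a new
-- minimizer comparable with all members as long as one exists; a list kept
-- strictly increasing under ⊂ has at most a + 1 members, which bounds the
-- number of insertions.

module MaximalChain {a b : ℕ} (G : Graph a b) where

  open DecMembership {A = Subset a} (≡-dec Data.Bool._≟_) using () renaming (_∈?_ to _∈ˡ?_)
  open Minimizers G using (minimizer?)

  Increasing : List (Subset a) → Set
  Increasing = AllPairs _⊂_

  Extends : List (Subset a) → Subset a → Set
  Extends L Y = IsMinimizer G Y × All (Comparable Y) L × Y ∉ˡ L

  extends? : ∀ L Y → Dec (Extends L Y)
  extends? L Y = minimizer? Y ×-dec (All.all? (λ X → (Y ⊆? X) ⊎-dec (X ⊆? Y)) L ×-dec ¬? (Y ∈ˡ? L))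

  Saturated : List (Subset a) → Set
  Saturated L = ∀ Y → IsMinimizer G Y → All (Comparable Y) L → Y ∈ˡ L

  insert : Subset a → List (Subset a) → List (Subset a)
  insert Y []      = Y ∷ []
  insert Y (X ∷ L) with Y ⊆? X
  ... | yes _ = Y ∷ X ∷ L
  ... | no  _ = X ∷ insert Y L

  insert-All : ∀ {P : Subset a → Set} {Y} L → P Y → All P L → All P (insert Y L)
  insert-All            []      pY []         = pY ∷ []
  insert-All {Y = Y} (X ∷ L) pY (pX ∷ pL) with Y ⊆? X
  ... | yes _ = pY ∷ pX ∷ pL
  ... | no  _ = pX ∷ insert-All L pY pL

  insert-length : ∀ Y L → length (insert Y L) ≡ suc (length L)
  insert-length Y []      = refl
  insert-length Y (X ∷ L) with Y ⊆? X
  ... | yes _ = refl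
  ... | no  _ = cong suc (insert-length Y L)

  insert-increasing : ∀ {Y} L → All (Comparable Y) L → Y ∉ˡ L → Increasing L → Increasing (insert Y L)
  insert-increasing []      _         _    _             = [] ∷ []
  insert-increasing {Y} (X ∷ L) (Y~X ∷ Y~L) Y∉XL (X<L ∷ incL) with Y ⊆? X
  ... | yes Y⊆X = (Y⊂X ∷ All.map (⊂-trans Y⊂X) X<L) ∷ X<L ∷ incL
    where Y⊂X = ⊆∧≢⇒⊂ Y⊆X (Y∉XL ∘ here)
  ... | no  Y⊈X with Y~X
  ...   | inj₁ Y⊆X = ⊥-elim (Y⊈X Y⊆X)
  ...   | inj₂ X⊆Y = insert-All L (⊆∧≢⇒⊂ X⊆Y (Y∉XL ∘ here ∘ sym)) X<L ∷ insert-increasing L Y~L (Y∉XL ∘ there) incL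

  -- Each strict step adds an element, so at most a - |X| members follow X.
  increasing-room : ∀ X L → Increasing (X ∷ L) → length L + ∣ X ∣ ≤ a
  increasing-room X []      _                   = ∣p∣≤n X
  increasing-room X (Y ∷ L) ((X⊂Y ∷ _) ∷ incYL) = begin
    suc (length L) + ∣ X ∣ ≡⟨ ℕP.+-suc (length L) ∣ X ∣ ⟨
    length L + suc ∣ X ∣   ≤⟨ ℕP.+-monoʳ-≤ (length L) (p⊂q⇒∣p∣<∣q∣ X⊂Y) ⟩
    length L + ∣ Y ∣       ≤⟨ increasing-room Y L incYL ⟩
    a                      ∎
    where open ℕP.≤-Reasoning

  increasing-length : ∀ L → Increasing L → length L ≤ suc a
  increasing-length []      _   = z≤n
  increasing-length (X ∷ L) inc = s≤s (ℕP.≤-trans (ℕP.m≤m+n (length L) ∣ X ∣) (increasing-room X L inc))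

  SaturatedChain : Set
  SaturatedChain = ∃ λ L → Increasing L × All (IsMinimizer G) L × Saturated L

  -- Repeated insertion; fuel + length = a + 2 exceeds every possible length,
  -- so the fuel never runs out.
  saturate : (fuel : ℕ) (L : List (Subset a)) → fuel + length L ≡ suc (suc a) →
    Increasing L → All (IsMinimizer G) L → SaturatedChain
  saturate zero L len≡ inc _ =
    ⊥-elim (ℕP.<-irrefl refl (ℕP.≤-trans (ℕP.≤-reflexive (cong suc (sym len≡))) (s≤s (increasing-length L inc))))
  saturate (suc fuel) L len≡ inc minL with anySubset? (extends? L)
  ... | yes (Y , minY , Y~L , Y∉L) =
    saturate fuel (insert Y L) len≡′ (insert-increasing L Y~L Y∉L inc) (insert-All L minY minL)
    where
    len≡′ : fuel + length (insert Y L) ≡ suc (suc a)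
    len≡′ = trans (cong (λ l → fuel + l) (insert-length Y L)) (trans (ℕP.+-suc fuel (length L)) len≡)
  ... | no none = L , inc , minL , λ Y minY Y~L →
    decidable-stable (Y ∈ˡ? L) (λ Y∉L → none (Y , minY , Y~L , Y∉L))

  lookup-increasing : ∀ X L → Increasing (X ∷ L) → (j : Fin (length L)) →
    List.lookup (X ∷ L) (inject₁ j) ⊂ List.lookup (X ∷ L) (suc j)
  lookup-increasing X (Y ∷ L) ((X⊂Y ∷ _) ∷ _) zero    = X⊂Y
  lookup-increasing X (Y ∷ L) (_ ∷ incYL)     (suc j) = lookup-increasing Y L incYL j

  maximal-chain : Σ (Chain G) IsMaximal
  maximal-chain with saturate (suc (suc a)) [] (ℕP.+-identityʳ _) [] []
  ... | [] , _ , _ , saturated with saturated (proj₁ (minimizer-exists G)) (proj₂ (minimizer-exists G)) []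
  ...   | ()
  maximal-chain | X₀ ∷ L , inc , minL , saturated = chain , maximal
    where
    chain : Chain G
    chain = record
      { k      = length L
      ; X      = List.lookup (X₀ ∷ L)
      ; isMin  = λ i → All.lookup minL (∈-lookup i)
      ; strict = lookup-increasing X₀ L inc
      }
    maximal : IsMaximal chain
    maximal Y minY Y~chain = index Y∈L , sym (lookup-index Y∈L)
      where
      Y∈L : Y ∈ˡ X₀ ∷ L
      Y∈L = saturated Y minY (subst (All (Comparable Y)) (tabulate-lookup (X₀ ∷ L)) (tabulate⁺ Y~chain))

open MaximalChain using (maximal-chain)

-- When |V⁺| < |V⁻|, DM-irreducibility forces ∅ to be the only minimizer:
-- V₀ = V or V₁ = V would give a full minimizer with full neighbourhood, and
-- V_∞ = V puts ∅ at the top of a maximal chain, above which no minimizer lies.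
irreducible⇒only-empty : ∀ {a b} {G : Graph a b} → a < b → DMIrreducible G → OnlyEmptyMinimizer G
irreducible⇒only-empty {G = G} a<b irr Y minY with maximal-chain G
... | C , maxC with irr C maxC
... | inj₁ (bottom≡⊤ , Γbottom≡⊤) = ⊥-elim (no-full-minimizer a<b bottom≡⊤ Γbottom≡⊤ (isMin C zero))
... | inj₂ (inj₁ V₁) with V₁-full C V₁
...   | _ , top≡⊤ , Γtop≡⊤ = ⊥-elim (no-full-minimizer a<b top≡⊤ Γtop≡⊤ (isMin C (fromℕ (k C))))
irreducible⇒only-empty a<b irr Y minY | C , maxC | inj₂ (inj₂ V∞) =
  trans (maximal-above-top C maxC minY (≡⊥⇒⊆ (V∞-empty C V∞))) (V∞-empty C V∞)

-- The padded graph G' = (V⁺ ∪ Z⁺, V⁻; E ∪ (Z⁺ × V⁻))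
--
-- A subset of V⁺ ∪ Z⁺ either meets Z⁺, and then its neighbourhood is all of
-- V⁻, or it is A ∪ ∅ for some A ⊆ V⁺, and then it behaves as A does in G.

module Padding {m n : ℕ} (E : Graph m n) (m<n : m < n) where

  z : ℕ
  z = n ∸ m

  E′ : Graph (m + z) n
  E′ = extend E

  m+z≡n : m + z ≡ n
  m+z≡n = ℕP.m+[n∸m]≡n (ℕP.<⇒≤ m<n)

  z₀ : Fin z
  z₀ = Fin.fromℕ< (ℕP.m<n⇒0<n∸m m<n)

  extend-old : ∀ i y → E′ (i ↑ˡ z) y ≡ E i y
  extend-old i y rewrite splitAt-↑ˡ m i z = refl

  extend-new : ∀ j y → E′ (m ↑ʳ j) y ≡ true
  extend-new j y rewrite splitAt-↑ʳ m z j = refl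

  MeetsZ : Subset (m + z) → Set
  MeetsZ Y = ∃ λ j → lookup Y (m ↑ʳ j) ≡ true

  ⊤-meetsZ : MeetsZ ⊤
  ⊤-meetsZ = z₀ , lookup-replicate (m ↑ʳ z₀) true

  meetsZ-or-old : ∀ Y → MeetsZ Y ⊎ ∃ λ (A : Subset m) → Y ≡ A ++ ⊥
  meetsZ-or-old Y with Vec.splitAt m Y
  ... | A , B , refl with nonempty? B
  ...   | yes (j , j∈B) = inj₁ (j , trans (lookup-++ʳ A B j) ([]=⇒lookup j∈B))
  ...   | no  B-empty   = inj₂ (A , cong (A ++_) (Empty-unique B-empty))

  Γ-meetsZ : ∀ Y → MeetsZ Y → Γ E′ Y ≡ ⊤
  Γ-meetsZ Y (j , j∈Y) = tabulate-const λ y → anyFin-true (m ↑ʳ j) (cong₂ _∧_ j∈Y (extend-new j y))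

  Γ-old : ∀ A → Γ E′ (A ++ ⊥) ≡ Γ E A
  Γ-old A = tabulate-cong λ y → begin
      anyFin (λ x → lookup (A ++ ⊥) x ∧ E′ x y)
    ≡⟨ anyFin-++ m (λ x → lookup (A ++ ⊥) x ∧ E′ x y) ⟩
      anyFin (λ i → lookup (A ++ ⊥) (i ↑ˡ z) ∧ E′ (i ↑ˡ z) y)
        ∨ anyFin (λ j → lookup (A ++ ⊥) (m ↑ʳ j) ∧ E′ (m ↑ʳ j) y)
    ≡⟨ cong₂ _∨_ (anyFin-cong λ i → cong₂ _∧_ (lookup-++ˡ A ⊥ i) (extend-old i y))
                 (anyFin-false λ j → cong (_∧ E′ (m ↑ʳ j) y) (trans (lookup-++ʳ A ⊥ j) (lookup-replicate j false))) ⟩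
      anyFin (λ i → lookup A i ∧ E i y) ∨ false
    ≡⟨ ∨-identityʳ _ ⟩
      anyFin (λ i → lookup A i ∧ E i y)
    ∎
    where open ≡-Reasoning

  f-meetsZ : ∀ Y → MeetsZ Y → f E′ Y ≡ + n ℤ.- + ∣ Y ∣
  f-meetsZ Y meets = cong (λ c → + c ℤ.- + ∣ Y ∣) (trans (cong ∣_∣ (Γ-meetsZ Y meets)) (∣⊤∣≡n n))

  f-old : ∀ A → f E′ (A ++ ⊥) ≡ f E A
  f-old A = cong₂ (λ c d → + c ℤ.- + d) (cong ∣_∣ (Γ-old A)) (∣p++⊥∣≡∣p∣ A)

  meetsZ-above-⊥ : ∀ Y → MeetsZ Y → f E′ ⊥ ℤ.≤ f E′ Y
  meetsZ-above-⊥ Y meets = subst₂ ℤ._≤_ (sym (f-⊥ E′)) (sym (f-meetsZ Y meets))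
    (i≤j⇒0≤j-i (+≤+ (subst (∣ Y ∣ ≤_) m+z≡n (∣p∣≤n Y))))

  meetsZ-tie : ∀ Y → MeetsZ Y → f E′ Y ℤ.≤ f E′ ⊥ → Y ≡ ⊤
  meetsZ-tie Y meets fY≤f⊥ = ∣p∣≡n⇒p≡⊤ (ℕP.≤-antisym (∣p∣≤n Y) (subst (_≤ ∣ Y ∣) (sym m+z≡n) n≤∣Y∣))
    where
    n≤∣Y∣ : n ≤ ∣ Y ∣
    n≤∣Y∣ = drop‿+≤+ (i-j≤0⇒i≤j (subst₂ ℤ._≤_ (f-meetsZ Y meets) (f-⊥ E′) fY≤f⊥))

  f-⊤≡f-⊥ : f E′ ⊤ ≡ f E′ ⊥
  f-⊤≡f-⊥ = begin
    f E′ ⊤                  ≡⟨ f-meetsZ ⊤ ⊤-meetsZ ⟩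
    + n ℤ.- + ∣ ⊤ {m + z} ∣ ≡⟨ cong (λ d → + n ℤ.- + d) (trans (∣⊤∣≡n (m + z)) m+z≡n) ⟩
    + n ℤ.- + n             ≡⟨ +-inverseʳ (+ n) ⟩
    0ℤ                      ≡⟨ f-⊥ E′ ⟨
    f E′ ⊥                  ∎
    where open ≡-Reasoning

  ⊤′≢⊥′ : ⊤ {m + z} ≢ ⊥
  ⊤′≢⊥′ = ⊤≢⊥ (m ↑ʳ z₀)

  old≢⊤ : ∀ A → A ++ ⊥ {z} ≢ ⊤
  old≢⊤ A A⊥≡⊤ = contradiction (begin
    false                     ≡⟨ lookup-replicate z₀ false ⟨
    lookup ⊥ z₀               ≡⟨ lookup-++ʳ A ⊥ z₀ ⟨
    lookup (A ++ ⊥) (m ↑ʳ z₀) ≡⟨ cong (λ v → lookup v (m ↑ʳ z₀)) A⊥≡⊤ ⟩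
    lookup ⊤ (m ↑ʳ z₀)        ≡⟨ lookup-replicate (m ↑ʳ z₀) true ⟩
    true                      ∎) λ ()
    where open ≡-Reasoning

  old-minimizer⁻ : ∀ A → IsMinimizer E′ (A ++ ⊥) → IsMinimizer E A
  old-minimizer⁻ A minA W = subst₂ ℤ._≤_ (f-old A) (f-old W) (minA (W ++ ⊥))

  old-minimizer⁺ : ∀ A → IsMinimizer E′ ⊥ → IsMinimizer E A → IsMinimizer E′ (A ++ ⊥)
  old-minimizer⁺ A min⊥ minA W = begin
    f E′ (A ++ ⊥) ≡⟨ f-old A ⟩
    f E A         ≤⟨ minA ⊥ ⟩
    f E ⊥         ≡⟨ trans (f-⊥ E) (sym (f-⊥ E′)) ⟩
    f E′ ⊥        ≤⟨ min⊥ W ⟩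
    f E′ W        ∎
    where open ℤP.≤-Reasoning

  ⊥-minimizer⁺ : IsMinimizer E ⊥ → IsMinimizer E′ ⊥
  ⊥-minimizer⁺ min⊥ Y with meetsZ-or-old Y
  ... | inj₁ meets    = meetsZ-above-⊥ Y meets
  ... | inj₂ (A , refl) = begin
    f E′ ⊥        ≡⟨ trans (f-⊥ E′) (sym (f-⊥ E)) ⟩
    f E ⊥         ≤⟨ min⊥ A ⟩
    f E A         ≡⟨ f-old A ⟨
    f E′ (A ++ ⊥) ∎
    where open ℤP.≤-Reasoning

  ⊥⇒⊤-minimizer : IsMinimizer E′ ⊥ → IsMinimizer E′ ⊤
  ⊥⇒⊤-minimizer = minimizer-≡f {G = E′} {⊥} {⊤} (sym f-⊤≡f-⊥)

  ⊤⇒⊥-minimizer : IsMinimizer E′ ⊤ → IsMinimizer E′ ⊥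
  ⊤⇒⊥-minimizer = minimizer-≡f {G = E′} {⊤} {⊥} f-⊤≡f-⊥

  padded-minimizers : OnlyEmptyMinimizer E → ∀ {Y} → IsMinimizer E′ Y → Y ≡ ⊥ ⊎ Y ≡ ⊤
  padded-minimizers only-∅ {Y} minY with meetsZ-or-old Y
  ... | inj₁ meets    = inj₂ (meetsZ-tie Y meets (minY ⊥))
  ... | inj₂ (A , refl) = inj₁ (trans (cong (_++ ⊥) (only-∅ A (old-minimizer⁻ A minY))) (⊥++⊥ m))

  -- Hence every maximal chain of G' is ∅ ⊂ V⁺ ∪ Z⁺ and V₁ = V.
  only-empty⇒padded-irreducible : OnlyEmptyMinimizer E → DMIrreducible E′
  only-empty⇒padded-irreducible only-∅ C maxC = inj₂ (inj₁ (V₁-intro C k≡1 bottom≡⊥ top≡⊤ (Γ-meetsZ ⊤ ⊤-meetsZ)))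
    where
    min⊥ : IsMinimizer E′ ⊥
    min⊥ = ⊥-minimizer⁺ (only-empty⇒⊥-minimizer E only-∅)
    bottom≡⊥ : X C zero ≡ ⊥
    bottom≡⊥ = sym (maximal-below-bottom C maxC min⊥ ⊥⊆)
    top≡⊤ : Top C ≡ ⊤
    top≡⊤ = sym (maximal-above-top C maxC (⊥⇒⊤-minimizer min⊥) ⊆⊤)
    k≡1 : k C ≡ 1
    k≡1 = two-valued-length (k C) (X C) (strict C) (λ i → padded-minimizers only-∅ (isMin C i)) bottom≡⊥ top≡⊤ ⊤′≢⊥′

  -- Conversely, ∅ and V⁺ ∪ Z⁺ tie in G', so a maximal chain of G' can have
  -- neither V₀ = V nor V_∞ = V; with V₁ = V it is ∅ ⊂ V⁺ ∪ Z⁺, and a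
  -- minimizer A of G gives the minimizer A ∪ ∅ of G', which must be ∅.
  padded-irreducible⇒only-empty : DMIrreducible E′ → OnlyEmptyMinimizer E
  padded-irreducible⇒only-empty irr A minA with maximal-chain E′
  ... | C , maxC with irr C maxC
  ... | inj₁ (bottom≡⊤ , _) = ⊥-elim (⊤′≢⊥′ (trans (sym bottom≡⊤) (sym ⊥≡bottom)))
    where
    ⊥≡bottom : ⊥ ≡ X C zero
    ⊥≡bottom = maximal-below-bottom C maxC
      (⊤⇒⊥-minimizer (subst (IsMinimizer E′) bottom≡⊤ (isMin C zero))) ⊥⊆
  ... | inj₂ (inj₂ V∞) = ⊥-elim (⊤′≢⊥′ (trans ⊤≡top (V∞-empty C V∞)))
    where
    ⊤≡top : ⊤ ≡ Top C
    ⊤≡top = maximal-above-top C maxC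
      (⊥⇒⊤-minimizer (subst (IsMinimizer E′) (V∞-empty C V∞) (isMin C (fromℕ (k C))))) ⊆⊤
  ... | inj₂ (inj₁ V₁) with V₁-full C V₁
  ...   | k≡1 , top≡⊤ , _ with maximal-two-members C maxC k≡1 bottom≡⊥ top≡⊤ {A ++ ⊥} (old-minimizer⁺ A min⊥ minA)
    where
    min⊥ : IsMinimizer E′ ⊥
    min⊥ = ⊤⇒⊥-minimizer (subst (IsMinimizer E′) top≡⊤ (isMin C (fromℕ (k C))))
    bottom≡⊥ : X C zero ≡ ⊥
    bottom≡⊥ = sym (maximal-below-bottom C maxC min⊥ ⊥⊆)
  ...     | inj₁ A⊥≡⊥ = ++-injectiveˡ A ⊥ (trans A⊥≡⊥ (sym (⊥++⊥ m)))
  ...     | inj₂ A⊥≡⊤ = ⊥-elim (old≢⊤ A A⊥≡⊤)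

lemma3p3 : (m n : ℕ) (E : Graph m n) → m < n →
    DMIrreducible E ⇔ DMIrreducible (extend E)
lemma3p3 m n E m<n = mk⇔
  (only-empty⇒padded-irreducible ∘ irreducible⇒only-empty m<n)
  (only-empty⇒irreducible ∘ padded-irreducible⇒only-empty)
  where open Padding E m<n
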